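{- The set $\mathcal{M}$ of all mutation classes of quivers, equipped with the mutation class topology, is compact: every cover of $\mathcal{M}$ by open sets admits a finite subcover.
   Context: A quiver is a finite directed multigraph (with at least one vertex) without loops and without oriented 2-cycles, with vertices labeled $1,\dots,n$. For a vertex $k$, the mutation $\mu_k(Q)$ is obtained by: (1) for each oriented path $i\to k\to j$ adding an arrow $i\to j$; (2) reversing all arrows incident to $k$; (3) removing a maximal collection of pairwise-disjoint oriented 2-cycles created. Two quivers are mutation-equivalent if one is isomorphic to a quiver obtained from the other by a finite sequence of mutations; the mutation class $[Q]$ is the equivalence class of $Q$. For $I\subseteq[n]$, the full subquiver $Q_I$ has vertex set $I$ and all arrows of $Q$ between vertices of $I$. A mutation class $[P]$ embeds into $[Q]$, written $[P]\preceq[Q]$, if some $P'\in[P]$ is isomorphic to a full subquiver of some $Q'\in[Q]$; this is a partial order on the set $\mathcal{M}$ of all mutation classes. The mutation class topology on $\mathcal{M}$ is the Alexandrov topology of $\preceq$: closed sets are the down-sets (if $[Q]\in S$ and $[P]\preceq[Q]$ then $[P]\in S$), open sets are the up-sets. -}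

module Defs where

open import Data.Nat using (ℕ; suc; _+_; _*_; _∸_)
open import Data.Fin using (Fin; _≟_)
open import Data.Product using (Σ; ∃; _×_)
open import Data.Sum using (_⊎_)
open import Function.Bundles using (_↔_; Inverse)
open import Function.Definitions using (Injective)
open import Relation.Binary.PropositionalEquality using (_≡_)
open import Relation.Nullary using (yes; no)

-- Arrow-count matrix on n labelled vertices: b i j = number of arrows i → j.
Mat : ℕ → Set
Mat n = Fin n → Fin n → ℕ

record Quiver : Set where
  field
    n      : ℕ
    b      : Mat (suc n)
    noLoop : ∀ i → b i i ≡ 0
    no2cyc : ∀ i j → b i j ≡ 0 ⊎ b j i ≡ 0
open Quiver public

-- Mutation at vertex k (steps (1)-(3)): arrows incident to k are reversed;
-- for i, j ≠ k, after adding b i k * b k j arrows i → j (for each path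
-- i → k → j) the maximal set of 2-cycles is cancelled, leaving the net count.
mutate : ∀ {n} → Mat n → Fin n → Mat n
mutate b k i j with i ≟ k | j ≟ k
... | yes _ | _     = b j i
... | no _  | yes _ = b j i
... | no _  | no _  = (b i j + b i k * b k j) ∸ (b j i + b j k * b k i)

data Mutations {n : ℕ} : Mat n → Mat n → Set where
  done : ∀ {b} → Mutations b b
  step : ∀ {b c} (k : Fin n) → Mutations (mutate b k) c → Mutations b c

Iso : ∀ {m n} → Mat m → Mat n → Set
Iso {m} {n} b c = Σ (Fin m ↔ Fin n) λ σ →
  ∀ i j → c (Inverse.to σ i) (Inverse.to σ j) ≡ b i j

MutEq : Quiver → Quiver → Set
MutEq P Q = Σ (Mat (suc (n P))) λ R → Mutations (b P) R × Iso R (b Q)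

FullSub : ∀ {m n} → Mat m → Mat n → Set
FullSub {m} {n} b c = Σ (Fin m → Fin n) λ f →
  Injective _≡_ _≡_ f × (∀ i j → c (f i) (f j) ≡ b i j)

_⪯_ : Quiver → Quiver → Set
P ⪯ Q = ∃ λ P' → ∃ λ Q' → MutEq P P' × MutEq Q Q' × FullSub (b P') (b Q')

-- Subsets of the set M of mutation classes are represented by predicates on
-- quivers; an open set of the Alexandrov topology is an up-set for ⪯
-- (this also makes it invariant under mutation equivalence, i.e. a genuine
-- subset of M).
IsOpen : ∀ {ℓ} → (Quiver → Set ℓ) → Set ℓ
IsOpen U = ∀ P Q → P ⪯ Q → U P → U Q

{-# OPTIONS --safe #-}

-- The one-vertex quiver A₁ is the least element of ⪯, since it is a full
-- subquiver of every quiver.  An up-set containing A₁ is therefore all of M,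
-- so any open cover is refined by the single open set containing A₁.

module Submission where

open import Defs
open import Level using (Level)
open import Data.List using (List; [_])
open import Data.List.Relation.Unary.Any using (Any; here)
open import Data.Product using (∃; Σ; _,_)
open import Data.Sum using (inj₁)
open import Data.Nat using (suc)
open import Data.Fin using (Fin; zero)
open import Function.Definitions using (Injective)
open import Function.Construct.Identity using (↔-id)
open import Relation.Binary.PropositionalEquality using (_≡_; refl)

A₁ : Quiver
A₁ = record
  { n      = 0
  ; b      = λ _ _ → 0
  ; noLoop = λ _ → refl
  ; no2cyc = λ _ _ → inj₁ refl
  }

MutEq-refl : ∀ Q → MutEq Q Q
MutEq-refl Q = b Q , done , ↔-id _ , λ _ _ → refl

const-injective : ∀ {A : Set} (a : A) → Injective _≡_ _≡_ (λ (_ : Fin 1) → a)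
const-injective a {zero} {zero} _ = refl

A₁-FullSub : ∀ Q (v : Fin (suc (n Q))) → FullSub (b A₁) (b Q)
A₁-FullSub Q v = (λ _ → v) , const-injective v , λ _ _ → noLoop Q v

A₁-⪯-least : ∀ Q → A₁ ⪯ Q
A₁-⪯-least Q = A₁ , Q , MutEq-refl A₁ , MutEq-refl Q , A₁-FullSub Q zero

IsOpen-A₁⇒universal : ∀ {ℓ} {U : Quiver → Set ℓ} → IsOpen U → U A₁ → ∀ Q → U Q
IsOpen-A₁⇒universal open-U U-A₁ Q = open-U A₁ Q (A₁-⪯-least Q) U-A₁

proposition3p5 : ∀ {ι ℓ : Level} (I : Set ι) (U : I → Quiver → Set ℓ) →
    (∀ i → IsOpen (U i)) →
    (∀ Q → ∃ λ i → U i Q) →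
    Σ (List I) λ is → ∀ Q → Any (λ i → U i Q) is
proposition3p5 I U open-U cover with cover A₁
... | i , U-i-A₁ = [ i ] , λ Q → here (IsOpen-A₁⇒universal (open-U i) U-i-A₁ Q)
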